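{- Let $q$ be a prime power, $\mathbb F$ a field extension of $\mathbb F_q$, and $f_1,f_2\in\mathbb F_q(X)\setminus\mathbb F_q$. If there exists $\psi\in G(\mathbb F)$ such that $f_2=\psi\circ f_1$, then there exists $\theta\in G(\mathbb F_q)$ such that $f_1=\theta\circ f_2$.
   Context: For a field $K$, $G(K)$ is the set of rational functions in $K(X)$ of degree $1$, i.e. $(aX+b)/(cX+d)$ with $a,b,c,d\in K$, $ad-bc\ne0$. -}

module Defs where

open import Level using (Level; _⊔_)
open import Data.Nat using (ℕ; zero; suc; _^_)
open import Data.Nat.Primality using (Prime)
open import Data.Fin using (Fin)
open import Data.List using (List; []; _∷_; map)
open import Data.Product using (Σ; ∃; _×_; _,_)
open import Relation.Nullary using (¬_)
open import Relation.Binary.PropositionalEquality using (_≡_)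
open import Algebra.Bundles using (CommutativeRing)
import Algebra.Morphism.Structures as MS

private
  variable
    c ℓ c₁ ℓ₁ c₂ ℓ₂ : Level

record IsField (R : CommutativeRing c ℓ) : Set (c ⊔ ℓ) where
  open CommutativeRing R
  field
    1≉0     : ¬ (1# ≈ 0#)
    inverse : ∀ x → ¬ (x ≈ 0#) → ∃ λ y → x * y ≈ 1#

record Field c ℓ : Set (Level.suc (c ⊔ ℓ)) where
  field
    commutativeRing : CommutativeRing c ℓ
    isField         : IsField commutativeRing
  open CommutativeRing commutativeRing public
  open IsField isField public

IsPrimePower : ℕ → Set
IsPrimePower q = ∃ λ p → ∃ λ k → Prime p × q ≡ p ^ suc k

HasCardinality : Field c ℓ → ℕ → Set (c ⊔ ℓ)
HasCardinality K q =
  Σ (Fin q → Carrier) λ e →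
    (∀ i j → e i ≈ e j → i ≡ j) × (∀ x → ∃ λ i → e i ≈ x)
  where open Field K

-- Field extensions L / K, given by a ring homomorphism K → L
-- (automatically injective since K is a field).

record Extension (K : Field c₁ ℓ₁) (L : Field c₂ ℓ₂) : Set (c₁ ⊔ ℓ₁ ⊔ c₂ ⊔ ℓ₂) where
  private
    module K = Field K
    module L = Field L
  open MS.RingMorphisms K.rawRing L.rawRing
  field
    ι     : K.Carrier → L.Carrier
    isHom : IsRingHomomorphism ι

-- Polynomials over a commutative ring: coefficient lists, lowest degree
-- first; equality is coefficientwise (so trailing zeros are irrelevant).

module Poly (R : CommutativeRing c ℓ) where
  open CommutativeRing R

  Pol : Set c
  Pol = List Carrier

  coeff : Pol → ℕ → Carrier
  coeff []      _       = 0#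
  coeff (a ∷ p) zero    = a
  coeff (a ∷ p) (suc i) = coeff p i

  _≈ₚ_ : Pol → Pol → Set ℓ
  p ≈ₚ q = ∀ i → coeff p i ≈ coeff q i

  NonZeroPol : Pol → Set ℓ
  NonZeroPol p = ∃ λ i → ¬ (coeff p i ≈ 0#)

  _+ₚ_ : Pol → Pol → Pol
  []      +ₚ q       = q
  (a ∷ p) +ₚ []      = a ∷ p
  (a ∷ p) +ₚ (b ∷ q) = (a + b) ∷ (p +ₚ q)

  _·ₚ_ : Carrier → Pol → Pol
  k ·ₚ p = map (k *_) p

  _*ₚ_ : Pol → Pol → Pol
  []      *ₚ q = []
  (a ∷ p) *ₚ q = (a ·ₚ q) +ₚ (0# ∷ (p *ₚ q))

  record RatFun : Set (c ⊔ ℓ) where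
    constructor _/_∶_
    field
      num   : Pol
      den   : Pol
      den≢0 : NonZeroPol den
  open RatFun public

  _≃_ : RatFun → RatFun → Set ℓ
  f ≃ g = (num f *ₚ den g) ≈ₚ (num g *ₚ den f)

  IsConstant : RatFun → Set (c ⊔ ℓ)
  IsConstant f = ∃ λ k → num f ≈ₚ (k ·ₚ den f)

  -- Elements of G(R): (aX + b)/(cX + d) with ad − bc ≠ 0.
  record Möbius : Set (c ⊔ ℓ) where
    constructor möb
    field
      a b c′ d : Carrier
      det≢0    : ¬ ((a * d - b * c′) ≈ 0#)

  -- "N₂/D₂ = ψ ∘ (N₁/D₁)" for ψ = (aX+b)/(cX+d):
  -- ψ ∘ (N₁/D₁) = (a N₁ + b D₁)/(c N₁ + d D₁), and equality in R(X)
  -- is expressed by cross-multiplication.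
  IsCompOf : Möbius → (N₁ D₁ N₂ D₂ : Pol) → Set ℓ
  IsCompOf ψ N₁ D₁ N₂ D₂ =
    (N₂ *ₚ ((c′ ·ₚ N₁) +ₚ (d ·ₚ D₁))) ≈ₚ (D₂ *ₚ ((a ·ₚ N₁) +ₚ (b ·ₚ D₁)))
    where open Möbius ψ

module _ {K : Field c₁ ℓ₁} {L : Field c₂ ℓ₂} (E : Extension K L) where
  private
    module K = Field K
    module L = Field L
    module PK = Poly K.commutativeRing
    module PL = Poly L.commutativeRing
  open Extension E

  mapPol : PK.Pol → PL.Pol
  mapPol = map ι

  _≡_∘ᴸ_ : PK.RatFun → PL.Möbius → PK.RatFun → Set ℓ₂
  f₂ ≡ ψ ∘ᴸ f₁ = PL.IsCompOf ψ (mapPol (PK.num f₁)) (mapPol (PK.den f₁))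
                               (mapPol (PK.num f₂)) (mapPol (PK.den f₂))

-- If f₂ = ψ ∘ f₁ with ψ = (aX + b)/(cX + d) ∈ G(𝔽), clearing denominators gives the
-- relation c N₁N₂ − a N₁D₂ + d D₁N₂ − b D₁D₂ = 0, an 𝔽-linear relation among four
-- polynomials over 𝔽_q.  Gaussian elimination on these polynomials turns it into a
-- nontrivial 𝔽_q-linear relation m₁ N₁N₂ + m₂ N₁D₂ + m₃ D₁N₂ + m₄ D₁D₂ = 0, which says
-- f₁ = θ ∘ f₂ for θ = (−m₃X − m₄)/(m₁X + m₂).  If det θ were 0, the numerator and the
-- denominator of f₁ or of f₂ would be linearly dependent, i.e. f₁ or f₂ would be constant.
-- Finiteness of 𝔽_q is only used to decide equality in it.

module Submission where

open import Defs
open import Level using (Level; _⊔_)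
open import Algebra.Bundles using (CommutativeRing)
open import Algebra.Morphism.Structures using (module RingMorphisms)
import Algebra.Morphism.Construct.Identity as Identity
import Algebra.Solver.Ring
open import Algebra.Solver.Ring.AlmostCommutativeRing
  using (fromCommutativeRing; _-Raw-AlmostCommutative⟶_)
open import Data.Empty using (⊥-elim)
import Data.Fin as Fin
open import Data.Integer as ℤ using (ℤ; +_; -[1+_]; _⊖_; sign; ∣_∣)
import Data.Integer.Properties as ℤ
open import Data.List using ([]; _∷_; map)
open import Data.Maybe using (Maybe; just; nothing)
open import Data.Nat as ℕ using (ℕ; zero; suc)
import Data.Nat.Properties as ℕ
open import Data.Product using (∃; _×_; _,_; proj₁; proj₂)
open import Data.Sign as Sign using (Sign)
open import Data.Sum using (_⊎_; inj₁; inj₂; [_,_]′)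
open import Data.Vec as Vec using (Vec; []; _∷_)
open import Data.Vec.Relation.Unary.All as All using (All; []; _∷_)
open import Data.Vec.Relation.Unary.All.Properties using (map⁻; tabulate⁺)
open import Function using (id)
open import Relation.Binary.Definitions using (Decidable)
import Relation.Binary.PropositionalEquality as ≡
open import Relation.Nullary using (¬_; Dec; yes; no)

-- The solver compares normal forms by refl, so their coefficients must be concrete:
-- integers, interpreted in R through the canonical map ℤ → R.
module IntegerCoefficients {c ℓ} (R : CommutativeRing c ℓ) where
  open CommutativeRing R
  open import Algebra.Properties.Semiring.Mult semiring using (×-homo-+; ×1-homo-*)
    renaming (_×_ to _·_)
  open import Algebra.Properties.Ring ring using (-‿involutive; -‿distribˡ-*; -0#≈0#)
  open import Algebra.Properties.AbelianGroup +-abelianGroup using (⁻¹-∙-comm)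
  open import Algebra.Properties.CommutativeSemigroup +-commutativeSemigroup using (interchange)
  open import Relation.Binary.Reasoning.Setoid setoid

  ⟦_⟧ : ℤ → Carrier
  ⟦ + n ⟧    = n · 1#
  ⟦ -[1+ n ] ⟧ = - (suc n · 1#)

  sign⟦_⟧ : Sign → Carrier
  sign⟦ Sign.+ ⟧ = 1#
  sign⟦ Sign.- ⟧ = - 1#

  ⟦-⟧-homo : ∀ i → ⟦ ℤ.- i ⟧ ≈ - ⟦ i ⟧
  ⟦-⟧-homo (+ zero)  = sym -0#≈0#
  ⟦-⟧-homo (+ suc n) = refl
  ⟦-⟧-homo -[1+ n ]  = sym (-‿involutive _)

  ⟦⊖⟧-homo : ∀ m n → ⟦ m ⊖ n ⟧ ≈ m · 1# - n · 1#
  ⟦⊖⟧-homo zero    zero    = sym (trans (+-identityˡ _) -0#≈0#)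
  ⟦⊖⟧-homo zero    (suc n) = sym (+-identityˡ _)
  ⟦⊖⟧-homo (suc m) zero    = sym (trans (+-congˡ -0#≈0#) (+-identityʳ _))
  ⟦⊖⟧-homo (suc m) (suc n) = begin
    ⟦ suc m ⊖ suc n ⟧                  ≡⟨ ≡.cong ⟦_⟧ (ℤ.[1+m]⊖[1+n]≡m⊖n m n) ⟩
    ⟦ m ⊖ n ⟧                          ≈⟨ ⟦⊖⟧-homo m n ⟩
    m · 1# - n · 1#                    ≈⟨ +-identityˡ _ ⟨
    0# + (m · 1# - n · 1#)             ≈⟨ +-congʳ (-‿inverseʳ 1#) ⟨
    (1# - 1#) + (m · 1# - n · 1#)      ≈⟨ interchange _ _ _ _ ⟩
    (1# + m · 1#) + (- 1# + - (n · 1#)) ≈⟨ +-congˡ (⁻¹-∙-comm 1# _) ⟩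
    (1# + m · 1#) - (1# + n · 1#)      ∎

  ⟦+⟧-homo : ∀ i j → ⟦ i ℤ.+ j ⟧ ≈ ⟦ i ⟧ + ⟦ j ⟧
  ⟦+⟧-homo (+ m)    (+ n)    = ×-homo-+ 1# m n
  ⟦+⟧-homo (+ m)    -[1+ n ] = ⟦⊖⟧-homo m (suc n)
  ⟦+⟧-homo -[1+ m ] (+ n)    = trans (⟦⊖⟧-homo n (suc m)) (+-comm _ _)
  ⟦+⟧-homo -[1+ m ] -[1+ n ] = begin
    - (suc (suc (m ℕ.+ n)) · 1#)    ≡⟨ ≡.cong (λ k → - (suc k · 1#)) (ℕ.+-suc m n) ⟨
    - ((suc m ℕ.+ suc n) · 1#)      ≈⟨ -‿cong (×-homo-+ 1# (suc m) (suc n)) ⟩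
    - (suc m · 1# + suc n · 1#)     ≈⟨ ⁻¹-∙-comm _ _ ⟨
    - (suc m · 1#) + - (suc n · 1#) ∎

  ⟦◃⟧-homo : ∀ s n → ⟦ s ℤ.◃ n ⟧ ≈ sign⟦ s ⟧ * (n · 1#)
  ⟦◃⟧-homo s        zero    = sym (zeroʳ _)
  ⟦◃⟧-homo Sign.+ (suc n) = sym (*-identityˡ _)
  ⟦◃⟧-homo Sign.- (suc n) = trans (-‿cong (sym (*-identityˡ _))) (-‿distribˡ-* 1# _)

  sign⟦*⟧-homo : ∀ s t → sign⟦ s Sign.* t ⟧ ≈ sign⟦ s ⟧ * sign⟦ t ⟧
  sign⟦*⟧-homo Sign.+ Sign.+ = sym (*-identityˡ _)
  sign⟦*⟧-homo Sign.+ Sign.- = sym (*-identityˡ _)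
  sign⟦*⟧-homo Sign.- Sign.+ = sym (*-identityʳ _)
  sign⟦*⟧-homo Sign.- Sign.- = begin
    1#                ≈⟨ -‿involutive 1# ⟨
    - - 1#            ≈⟨ -‿cong (-‿cong (*-identityˡ 1#)) ⟨
    - - (1# * 1#)     ≈⟨ -‿cong (-‿distribˡ-* 1# 1#) ⟩
    - (- 1# * 1#)     ≈⟨ -‿distribʳ-* (- 1#) 1# ⟩
    - 1# * - 1#       ∎
    where open import Algebra.Properties.Ring ring using (-‿distribʳ-*)

  ⟦⟧-sign-abs : ∀ i → ⟦ i ⟧ ≈ sign⟦ sign i ⟧ * (∣ i ∣ · 1#)
  ⟦⟧-sign-abs i =
    trans (reflexive (≡.cong ⟦_⟧ (≡.sym (ℤ.◃-inverse i)))) (⟦◃⟧-homo (sign i) ∣ i ∣)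

  ⟦*⟧-homo : ∀ i j → ⟦ i ℤ.* j ⟧ ≈ ⟦ i ⟧ * ⟦ j ⟧
  ⟦*⟧-homo i j = begin
    ⟦ i ℤ.* j ⟧
      ≈⟨ ⟦◃⟧-homo (sign i Sign.* sign j) (∣ i ∣ ℕ.* ∣ j ∣) ⟩
    sign⟦ sign i Sign.* sign j ⟧ * ((∣ i ∣ ℕ.* ∣ j ∣) · 1#)
      ≈⟨ *-cong (sign⟦*⟧-homo (sign i) (sign j)) (×1-homo-* ∣ i ∣ ∣ j ∣) ⟩
    (sign⟦ sign i ⟧ * sign⟦ sign j ⟧) * ((∣ i ∣ · 1#) * (∣ j ∣ · 1#))
      ≈⟨ *-interchange _ _ _ _ ⟩
    (sign⟦ sign i ⟧ * (∣ i ∣ · 1#)) * (sign⟦ sign j ⟧ * (∣ j ∣ · 1#))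
      ≈⟨ *-cong (⟦⟧-sign-abs i) (⟦⟧-sign-abs j) ⟨
    ⟦ i ⟧ * ⟦ j ⟧ ∎
    where open import Algebra.Properties.CommutativeSemigroup *-commutativeSemigroup
            using () renaming (interchange to *-interchange)

  homomorphism : ℤ.+-*-rawRing -Raw-AlmostCommutative⟶ fromCommutativeRing R
  homomorphism = record
    { ⟦_⟧    = ⟦_⟧
    ; +-homo = ⟦+⟧-homo
    ; *-homo = ⟦*⟧-homo
    ; -‿homo = ⟦-⟧-homo
    ; 0-homo = refl
    ; 1-homo = +-identityʳ 1#
    }

  ⟦⟧-≟ : ∀ i j → Maybe (⟦ i ⟧ ≈ ⟦ j ⟧)
  ⟦⟧-≟ i j with i ℤ.≟ j
  ... | yes ≡.refl = just refl
  ... | no _       = nothing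

  open Algebra.Solver.Ring ℤ.+-*-rawRing (fromCommutativeRing R) homomorphism ⟦⟧-≟
    public using (solve; _:=_; _:+_; _:*_; :-_; _:-_; con)

module PolynomialProperties {c ℓ} (R : CommutativeRing c ℓ) where
  open CommutativeRing R hiding (zero)
  open Poly R
  open IntegerCoefficients R using (solve; _:=_; _:+_; _:*_)
  open import Relation.Binary.Reasoning.Setoid setoid

  coeff-+ₚ : ∀ p q i → coeff (p +ₚ q) i ≈ coeff p i + coeff q i
  coeff-+ₚ []      q       i       = sym (+-identityˡ _)
  coeff-+ₚ (a ∷ p) []      i       = sym (+-identityʳ _)
  coeff-+ₚ (a ∷ p) (b ∷ q) zero    = refl
  coeff-+ₚ (a ∷ p) (b ∷ q) (suc i) = coeff-+ₚ p q i

  coeff-·ₚ : ∀ k p i → coeff (k ·ₚ p) i ≈ k * coeff p i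
  coeff-·ₚ k []      i       = sym (zeroʳ k)
  coeff-·ₚ k (a ∷ p) zero    = refl
  coeff-·ₚ k (a ∷ p) (suc i) = coeff-·ₚ k p i

  eliminate : ℕ → Pol → Pol → Pol
  eliminate r u w = (coeff u r ·ₚ w) +ₚ ((- coeff w r) ·ₚ u)

  coeff-linear : ∀ k p l q i → coeff ((k ·ₚ p) +ₚ (l ·ₚ q)) i ≈ k * coeff p i + l * coeff q i
  coeff-linear k p l q i = trans (coeff-+ₚ (k ·ₚ p) (l ·ₚ q) i) (+-cong (coeff-·ₚ k p i) (coeff-·ₚ l q i))

  coeff-∷-*ₚ : ∀ a p q i → coeff ((a ∷ p) *ₚ q) i ≈ a * coeff q i + coeff (0# ∷ (p *ₚ q)) i
  coeff-∷-*ₚ a p q i = trans (coeff-+ₚ (a ·ₚ q) _ i) (+-congʳ (coeff-·ₚ a q i))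

  *ₚ-zeroʳ : ∀ p → (p *ₚ []) ≈ₚ []
  *ₚ-zeroʳ []      i       = refl
  *ₚ-zeroʳ (a ∷ p) zero    = refl
  *ₚ-zeroʳ (a ∷ p) (suc i) = *ₚ-zeroʳ p i

  *ₚ-∷ʳ : ∀ p b q → (p *ₚ (b ∷ q)) ≈ₚ ((b ·ₚ p) +ₚ (0# ∷ (p *ₚ q)))
  *ₚ-∷ʳ []      b q zero    = refl
  *ₚ-∷ʳ []      b q (suc i) = refl
  *ₚ-∷ʳ (a ∷ p) b q zero    = +-congʳ (*-comm a b)
  *ₚ-∷ʳ (a ∷ p) b q (suc i) = begin
    coeff ((a ·ₚ q) +ₚ (p *ₚ (b ∷ q))) i
      ≈⟨ coeff-+ₚ (a ·ₚ q) _ i ⟩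
    coeff (a ·ₚ q) i + coeff (p *ₚ (b ∷ q)) i
      ≈⟨ +-congˡ (trans (*ₚ-∷ʳ p b q i) (coeff-+ₚ (b ·ₚ p) _ i)) ⟩
    coeff (a ·ₚ q) i + (coeff (b ·ₚ p) i + coeff (0# ∷ (p *ₚ q)) i)
      ≈⟨ x∙yz≈y∙xz _ _ _ ⟩
    coeff (b ·ₚ p) i + (coeff (a ·ₚ q) i + coeff (0# ∷ (p *ₚ q)) i)
      ≈⟨ +-congˡ (coeff-+ₚ (a ·ₚ q) _ i) ⟨
    coeff (b ·ₚ p) i + coeff ((a ·ₚ q) +ₚ (0# ∷ (p *ₚ q))) i
      ≈⟨ coeff-+ₚ (b ·ₚ p) _ i ⟨
    coeff ((b ·ₚ p) +ₚ ((a ·ₚ q) +ₚ (0# ∷ (p *ₚ q)))) i ∎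
    where open import Algebra.Properties.CommutativeSemigroup +-commutativeSemigroup using (x∙yz≈y∙xz)

  *ₚ-comm : ∀ p q → (p *ₚ q) ≈ₚ (q *ₚ p)
  *ₚ-comm []      q i = sym (*ₚ-zeroʳ q i)
  *ₚ-comm (a ∷ p) q i = begin
    coeff ((a ∷ p) *ₚ q) i                       ≈⟨ coeff-+ₚ (a ·ₚ q) _ i ⟩
    coeff (a ·ₚ q) i + coeff (0# ∷ (p *ₚ q)) i   ≈⟨ +-congˡ (shifted i) ⟩
    coeff (a ·ₚ q) i + coeff (0# ∷ (q *ₚ p)) i   ≈⟨ coeff-+ₚ (a ·ₚ q) _ i ⟨
    coeff ((a ·ₚ q) +ₚ (0# ∷ (q *ₚ p))) i        ≈⟨ *ₚ-∷ʳ q a p i ⟨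
    coeff (q *ₚ (a ∷ p)) i                       ∎
    where
    shifted : ∀ i → coeff (0# ∷ (p *ₚ q)) i ≈ coeff (0# ∷ (q *ₚ p)) i
    shifted zero    = refl
    shifted (suc i) = *ₚ-comm p q i

  *ₚ-linearʳ : ∀ p k x l y i →
    coeff (p *ₚ ((k ·ₚ x) +ₚ (l ·ₚ y))) i ≈ k * coeff (p *ₚ x) i + l * coeff (p *ₚ y) i
  *ₚ-linearʳ []      k x l y i = begin
    0#            ≈⟨ zeroʳ k ⟨
    k * 0#        ≈⟨ +-identityʳ _ ⟨
    k * 0# + 0#   ≈⟨ +-congˡ (zeroʳ l) ⟨
    k * 0# + l * 0# ∎
  *ₚ-linearʳ (a ∷ p) k x l y i = begin
    coeff ((a ∷ p) *ₚ ((k ·ₚ x) +ₚ (l ·ₚ y))) i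
      ≈⟨ coeff-∷-*ₚ a p _ i ⟩
    a * coeff ((k ·ₚ x) +ₚ (l ·ₚ y)) i + coeff (0# ∷ (p *ₚ ((k ·ₚ x) +ₚ (l ·ₚ y)))) i
      ≈⟨ +-cong (*-congˡ (coeff-linear k x l y i)) (shifted i) ⟩
    a * (k * coeff x i + l * coeff y i) + (k * coeff (0# ∷ (p *ₚ x)) i + l * coeff (0# ∷ (p *ₚ y)) i)
      ≈⟨ solve 7 (λ a k l x y X Y → a :* (k :* x :+ l :* y) :+ (k :* X :+ l :* Y)
                                 := k :* (a :* x :+ X) :+ l :* (a :* y :+ Y))
                 refl a k l (coeff x i) (coeff y i) (coeff (0# ∷ (p *ₚ x)) i) (coeff (0# ∷ (p *ₚ y)) i) ⟩
    k * (a * coeff x i + coeff (0# ∷ (p *ₚ x)) i) + l * (a * coeff y i + coeff (0# ∷ (p *ₚ y)) i)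
      ≈⟨ +-cong (*-congˡ (coeff-∷-*ₚ a p x i)) (*-congˡ (coeff-∷-*ₚ a p y i)) ⟨
    k * coeff ((a ∷ p) *ₚ x) i + l * coeff ((a ∷ p) *ₚ y) i ∎
    where
    shifted : ∀ i → coeff (0# ∷ (p *ₚ ((k ·ₚ x) +ₚ (l ·ₚ y)))) i ≈
                    k * coeff (0# ∷ (p *ₚ x)) i + l * coeff (0# ∷ (p *ₚ y)) i
    shifted zero    = *ₚ-linearʳ [] k x l y zero
    shifted (suc i) = *ₚ-linearʳ p k x l y i

module FieldProperties {c ℓ} (K : Field c ℓ) where
  open Field K hiding (zero)
  open Poly commutativeRing
  open PolynomialProperties commutativeRing
  open IntegerCoefficients commutativeRing using (solve; _:=_; _:+_; _:*_; :-_; _:-_)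
  open import Algebra.Properties.Ring ring using (-‿injective; -0#≈0#; +-inverseˡ-unique)
  open import Relation.Binary.Reasoning.Setoid setoid

  x≉0⇒x*y≈0⇒y≈0 : ∀ {x y} → ¬ x ≈ 0# → x * y ≈ 0# → y ≈ 0#
  x≉0⇒x*y≈0⇒y≈0 {x} {y} x≉0 xy≈0 with inverse x x≉0
  ... | x⁻¹ , xx⁻¹≈1 = begin
    y              ≈⟨ *-identityˡ y ⟨
    1# * y         ≈⟨ *-congʳ xx⁻¹≈1 ⟨
    (x * x⁻¹) * y  ≈⟨ solve 3 (λ x x⁻¹ y → (x :* x⁻¹) :* y := x⁻¹ :* (x :* y)) refl x x⁻¹ y ⟩
    x⁻¹ * (x * y)  ≈⟨ *-congˡ xy≈0 ⟩
    x⁻¹ * 0#       ≈⟨ zeroʳ x⁻¹ ⟩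
    0#             ∎

  -x≈0⇒x≈0 : ∀ {x} → - x ≈ 0# → x ≈ 0#
  -x≈0⇒x≈0 -x≈0 = -‿injective (trans -x≈0 (sym -0#≈0#))

  x≈0∧y≈0⇒xu+yv≈0 : ∀ {x y} u v → x ≈ 0# → y ≈ 0# → x * u + y * v ≈ 0#
  x≈0∧y≈0⇒xu+yv≈0 u v x≈0 y≈0 = begin
    _ * u + _ * v  ≈⟨ +-cong (*-congʳ x≈0) (*-congʳ y≈0) ⟩
    0# * u + 0# * v ≈⟨ +-cong (zeroˡ u) (zeroˡ v) ⟩
    0# + 0#        ≈⟨ +-identityˡ 0# ⟩
    0#             ∎

  module WithDecidableZero (_≟0 : ∀ x → Dec (x ≈ 0#)) where

    ≈ₚ[]⊎NonZeroPol : ∀ p → p ≈ₚ [] ⊎ NonZeroPol p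
    ≈ₚ[]⊎NonZeroPol []      = inj₁ (λ _ → refl)
    ≈ₚ[]⊎NonZeroPol (a ∷ p) with a ≟0 | ≈ₚ[]⊎NonZeroPol p
    ... | no a≉0 | _              = inj₂ (zero , a≉0)
    ... | yes _  | inj₂ (i , pᵢ≉0) = inj₂ (suc i , pᵢ≉0)
    ... | yes a≈0 | inj₁ p≈0      = inj₁ λ { zero → a≈0 ; (suc i) → p≈0 i }

    -- Induction on q: the constant coefficient of (a ∷ p) *ₚ (b ∷ q) is a * b.
    a≉0⇒[a∷p]*q≈0⇒q≈0 : ∀ {a} p q → ¬ a ≈ 0# → ((a ∷ p) *ₚ q) ≈ₚ [] → q ≈ₚ []
    a≉0⇒[a∷p]*q≈0⇒q≈0 p []      a≉0 _    i = refl
    a≉0⇒[a∷p]*q≈0⇒q≈0 {a} p (b ∷ q) a≉0 prod≈0 = λ { zero → b≈0 ; (suc i) → q≈0 i }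
      where
      b≈0 : b ≈ 0#
      b≈0 = x≉0⇒x*y≈0⇒y≈0 a≉0 (begin
        a * b                               ≈⟨ *-comm a b ⟩
        b * a                               ≈⟨ +-identityʳ _ ⟨
        b * a + 0#                          ≈⟨ *ₚ-∷ʳ (a ∷ p) b q zero ⟨
        coeff ((a ∷ p) *ₚ (b ∷ q)) zero     ≈⟨ prod≈0 zero ⟩
        0#                                  ∎)
      q≈0 : q ≈ₚ []
      q≈0 = a≉0⇒[a∷p]*q≈0⇒q≈0 p q a≉0 λ i → begin
        coeff ((a ∷ p) *ₚ q) i                               ≈⟨ +-identityˡ _ ⟨
        0# + coeff ((a ∷ p) *ₚ q) i                          ≈⟨ +-congʳ (trans (*-congʳ b≈0) (zeroˡ _)) ⟨
        b * coeff (a ∷ p) (suc i) + coeff ((a ∷ p) *ₚ q) i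
          ≈⟨ trans (coeff-+ₚ (b ·ₚ (a ∷ p)) (0# ∷ ((a ∷ p) *ₚ q)) (suc i))
                   (+-congʳ (coeff-·ₚ b (a ∷ p) (suc i))) ⟨
        coeff ((b ·ₚ (a ∷ p)) +ₚ (0# ∷ ((a ∷ p) *ₚ q))) (suc i) ≈⟨ *ₚ-∷ʳ (a ∷ p) b q (suc i) ⟨
        coeff ((a ∷ p) *ₚ (b ∷ q)) (suc i)                   ≈⟨ prod≈0 (suc i) ⟩
        0#                                                   ∎

    p*q≈0⇒p≈0⊎q≈0 : ∀ p q → (p *ₚ q) ≈ₚ [] → p ≈ₚ [] ⊎ q ≈ₚ []
    p*q≈0⇒p≈0⊎q≈0 []      q _ = inj₁ (λ _ → refl)
    p*q≈0⇒p≈0⊎q≈0 (a ∷ p) q prod≈0 with a ≟0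
    ... | no a≉0  = inj₂ (a≉0⇒[a∷p]*q≈0⇒q≈0 p q a≉0 prod≈0)
    ... | yes a≈0 with p*q≈0⇒p≈0⊎q≈0 p q tail≈0
      where
      tail≈0 : (p *ₚ q) ≈ₚ []
      tail≈0 i = begin
        coeff (p *ₚ q) i                           ≈⟨ +-identityˡ _ ⟨
        0# + coeff (p *ₚ q) i                      ≈⟨ +-congʳ (trans (*-congʳ a≈0) (zeroˡ _)) ⟨
        a * coeff q (suc i) + coeff (p *ₚ q) i     ≈⟨ coeff-∷-*ₚ a p q (suc i) ⟨
        coeff ((a ∷ p) *ₚ q) (suc i)               ≈⟨ prod≈0 (suc i) ⟩
        0#                                         ∎
    ... | inj₁ p≈0 = inj₁ λ { zero → a≈0 ; (suc i) → p≈0 i }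
    ... | inj₂ q≈0 = inj₂ q≈0

    ¬IsConstant⇒independent : ∀ f → ¬ IsConstant f → ∀ x y →
      ((x ·ₚ num f) +ₚ (y ·ₚ den f)) ≈ₚ [] → x ≈ 0# × y ≈ 0#
    ¬IsConstant⇒independent f nonconst x y rel = x≈0 , y≈0
      where
      rel′ : ∀ i → x * coeff (num f) i + y * coeff (den f) i ≈ 0#
      rel′ i = trans (sym (coeff-linear x (num f) y (den f) i)) (rel i)
      x≈0 : x ≈ 0#
      x≈0 with x ≟0
      ... | yes x≈0 = x≈0
      ... | no x≉0 with inverse x x≉0
      ...   | x⁻¹ , xx⁻¹≈1 = ⊥-elim (nonconst (- (y * x⁻¹) , num≈k·den))
        where
        num≈k·den : num f ≈ₚ ((- (y * x⁻¹)) ·ₚ den f)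
        num≈k·den i = begin
          coeff (num f) i                  ≈⟨ *-identityˡ _ ⟨
          1# * coeff (num f) i             ≈⟨ *-congʳ xx⁻¹≈1 ⟨
          (x * x⁻¹) * coeff (num f) i
            ≈⟨ solve 3 (λ x x⁻¹ n → (x :* x⁻¹) :* n := x⁻¹ :* (x :* n)) refl x x⁻¹ _ ⟩
          x⁻¹ * (x * coeff (num f) i)
            ≈⟨ *-congˡ (+-inverseˡ-unique _ _ (rel′ i)) ⟩
          x⁻¹ * - (y * coeff (den f) i)
            ≈⟨ solve 3 (λ x⁻¹ y d → x⁻¹ :* (:- (y :* d)) := (:- (y :* x⁻¹)) :* d) refl x⁻¹ y _ ⟩
          - (y * x⁻¹) * coeff (den f) i    ≈⟨ coeff-·ₚ _ (den f) i ⟨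
          coeff ((- (y * x⁻¹)) ·ₚ den f) i ∎
      y≈0 : y ≈ 0#
      y≈0 with den≢0 f
      ... | i , dᵢ≉0 = x≉0⇒x*y≈0⇒y≈0 dᵢ≉0 (begin
        coeff (den f) i * y                         ≈⟨ *-comm _ y ⟩
        y * coeff (den f) i                         ≈⟨ +-identityˡ _ ⟨
        0# + y * coeff (den f) i                    ≈⟨ +-congʳ (trans (*-congʳ x≈0) (zeroˡ _)) ⟨
        x * coeff (num f) i + y * coeff (den f) i   ≈⟨ rel′ i ⟩
        0#                                          ∎)

    -- With A = a N_g + b D_g and C = c N_g + d D_g, ad − bc = 0 makes
    -- C (c N_f − a D_f) and C (d N_f − b D_f) vanish, so c = d = 0; then D_f A = N_f C = 0.
    singular-composition⇒0 : ∀ f g → ¬ IsConstant f → ¬ IsConstant g → ∀ a b c d →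
      (num f *ₚ ((c ·ₚ num g) +ₚ (d ·ₚ den g))) ≈ₚ (den f *ₚ ((a ·ₚ num g) +ₚ (b ·ₚ den g))) →
      a * d - b * c ≈ 0# → a ≈ 0# × b ≈ 0# × c ≈ 0# × d ≈ 0#
    singular-composition⇒0 f g f-nonconst g-nonconst a b c d f≡θ∘g det≈0 =
      proj₁ a≈0×b≈0 , proj₂ a≈0×b≈0 , c≈0 , d≈0
      where
      A C : Pol
      A = (a ·ₚ num g) +ₚ (b ·ₚ den g)
      C = (c ·ₚ num g) +ₚ (d ·ₚ den g)
      p r : ℕ → Carrier
      p i = coeff (den f *ₚ num g) i
      r i = coeff (den f *ₚ den g) i

      C*[sN+tD] : ∀ s t i → coeff (C *ₚ ((s ·ₚ num f) +ₚ (t ·ₚ den f))) i ≈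
                             s * (a * p i + b * r i) + t * (c * p i + d * r i)
      C*[sN+tD] s t i = begin
        coeff (C *ₚ ((s ·ₚ num f) +ₚ (t ·ₚ den f))) i
          ≈⟨ *ₚ-linearʳ C s (num f) t (den f) i ⟩
        s * coeff (C *ₚ num f) i + t * coeff (C *ₚ den f) i
          ≈⟨ +-cong (*-congˡ (trans (*ₚ-comm C (num f) i) (f≡θ∘g i))) (*-congˡ (*ₚ-comm C (den f) i)) ⟩
        s * coeff (den f *ₚ A) i + t * coeff (den f *ₚ C) i
          ≈⟨ +-cong (*-congˡ (*ₚ-linearʳ (den f) a (num g) b (den g) i))
                    (*-congˡ (*ₚ-linearʳ (den f) c (num g) d (den g) i)) ⟩
        s * (a * p i + b * r i) + t * (c * p i + d * r i) ∎

      C≈0⊎s≈0 : ∀ s t → (∀ i → s * (a * p i + b * r i) + t * (c * p i + d * r i) ≈ 0#) →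
                c ≈ 0# × d ≈ 0# ⊎ s ≈ 0#
      C≈0⊎s≈0 s t vanishes with p*q≈0⇒p≈0⊎q≈0 C _ (λ i → trans (C*[sN+tD] s t i) (vanishes i))
      ... | inj₁ C≈0     = inj₁ (¬IsConstant⇒independent g g-nonconst c d C≈0)
      ... | inj₂ sN+tD≈0 = inj₂ (proj₁ (¬IsConstant⇒independent f f-nonconst s t sN+tD≈0))

      det*≈0 : ∀ u → (a * d - b * c) * u ≈ 0#
      det*≈0 u = trans (*-congʳ det≈0) (zeroˡ u)

      c≈0 : c ≈ 0#
      c≈0 = [ proj₁ , id ]′ (C≈0⊎s≈0 c (- a) λ i → begin
        c * (a * p i + b * r i) + (- a) * (c * p i + d * r i)
          ≈⟨ solve 6 (λ a b c d p r → c :* (a :* p :+ b :* r) :+ (:- a) :* (c :* p :+ d :* r)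
                                     := :- ((a :* d :- b :* c) :* r)) refl a b c d (p i) (r i) ⟩
        - ((a * d - b * c) * r i)  ≈⟨ -‿cong (det*≈0 (r i)) ⟩
        - 0#                       ≈⟨ -0#≈0# ⟩
        0#                         ∎)

      d≈0 : d ≈ 0#
      d≈0 = [ proj₂ , id ]′ (C≈0⊎s≈0 d (- b) λ i → begin
        d * (a * p i + b * r i) + (- b) * (c * p i + d * r i)
          ≈⟨ solve 6 (λ a b c d p r → d :* (a :* p :+ b :* r) :+ (:- b) :* (c :* p :+ d :* r)
                                     := (a :* d :- b :* c) :* p) refl a b c d (p i) (r i) ⟩
        (a * d - b * c) * p i      ≈⟨ det*≈0 (p i) ⟩
        0#                         ∎)

      D*A≈0 : (den f *ₚ A) ≈ₚ []
      D*A≈0 i = begin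
        coeff (den f *ₚ A) i    ≈⟨ f≡θ∘g i ⟨
        coeff (num f *ₚ C) i    ≈⟨ *ₚ-linearʳ (num f) c (num g) d (den g) i ⟩
        c * coeff (num f *ₚ num g) i + d * coeff (num f *ₚ den g) i
                                ≈⟨ x≈0∧y≈0⇒xu+yv≈0 _ _ c≈0 d≈0 ⟩
        0#                      ∎

      a≈0×b≈0 : a ≈ 0# × b ≈ 0#
      a≈0×b≈0 = [ (λ D≈0 → ⊥-elim (let i , dᵢ≉0 = den≢0 f in dᵢ≉0 (D≈0 i)))
                , ¬IsConstant⇒independent g g-nonconst a b
                ]′ (p*q≈0⇒p≈0⊎q≈0 (den f) A D*A≈0)

module LinearCombination {c₁ ℓ₁ c₂ ℓ₂} (R : CommutativeRing c₁ ℓ₁) (S : CommutativeRing c₂ ℓ₂)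
  {h : CommutativeRing.Carrier R → CommutativeRing.Carrier S}
  (isHom : RingMorphisms.IsRingHomomorphism (CommutativeRing.rawRing R) (CommutativeRing.rawRing S) h)
  where
  private module R = CommutativeRing R
  open CommutativeRing S hiding (zero)
  open Poly R using (Pol; coeff; _·ₚ_; _+ₚ_; _*ₚ_)
  module S = Poly S
  open PolynomialProperties R using (eliminate; coeff-linear; coeff-∷-*ₚ)
  open PolynomialProperties S using () renaming (coeff-∷-*ₚ to coeffₛ-∷-*ₚ)
  open RingMorphisms.IsRingHomomorphism isHom
  open IntegerCoefficients S using (solve; _:=_; _:+_; _:*_; :-_)
  open import Relation.Binary.Reasoning.Setoid setoid

  coeff-map : ∀ p i → S.coeff (map h p) i ≈ h (coeff p i)
  coeff-map []      i       = sym 0#-homo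
  coeff-map (a ∷ p) zero    = refl
  coeff-map (a ∷ p) (suc i) = coeff-map p i

  coeff-map-*ₚ : ∀ p q i → S.coeff (map h p S.*ₚ map h q) i ≈ h (coeff (p *ₚ q) i)
  coeff-map-*ₚ []      q i = sym 0#-homo
  coeff-map-*ₚ (a ∷ p) q i = begin
    S.coeff ((h a ∷ map h p) S.*ₚ map h q) i
      ≈⟨ coeffₛ-∷-*ₚ (h a) (map h p) (map h q) i ⟩
    h a * S.coeff (map h q) i + S.coeff (0# ∷ (map h p S.*ₚ map h q)) i
      ≈⟨ +-cong (*-congˡ (coeff-map q i)) (shifted i) ⟩
    h a * h (coeff q i) + h (coeff (R.0# ∷ (p *ₚ q)) i)
      ≈⟨ +-congʳ (*-homo a (coeff q i)) ⟨
    h (a R.* coeff q i) + h (coeff (R.0# ∷ (p *ₚ q)) i)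
      ≈⟨ +-homo _ _ ⟨
    h (a R.* coeff q i R.+ coeff (R.0# ∷ (p *ₚ q)) i)
      ≈⟨ ⟦⟧-cong (coeff-∷-*ₚ a p q i) ⟨
    h (coeff ((a ∷ p) *ₚ q) i) ∎
    where
    shifted : ∀ i → S.coeff (0# ∷ (map h p S.*ₚ map h q)) i ≈ h (coeff (R.0# ∷ (p *ₚ q)) i)
    shifted zero    = sym 0#-homo
    shifted (suc i) = coeff-map-*ₚ p q i

  combination : ∀ {n} → Vec Carrier n → Vec Pol n → ℕ → Carrier
  combination []       []       i = 0#
  combination (x ∷ xs) (u ∷ us) i = x * h (coeff u i) + combination xs us i

  NontrivialRelation : ∀ {n} → Vec Pol n → Set (c₂ ⊔ ℓ₂)
  NontrivialRelation {n} us =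
    ∃ λ (xs : Vec Carrier n) → ¬ All (_≈ 0#) xs × (∀ i → combination xs us i ≈ 0#)

  combination-zero : ∀ {n} {xs : Vec Carrier n} us i → All (_≈ 0#) xs → combination xs us i ≈ 0#
  combination-zero []       i []             = refl
  combination-zero {xs = x ∷ xs} (u ∷ us) i (x≈0 ∷ xs≈0) = begin
    x * h (coeff u i) + combination xs us i ≈⟨ +-cong (*-congʳ x≈0) (combination-zero us i xs≈0) ⟩
    0# * h (coeff u i) + 0#               ≈⟨ +-identityʳ _ ⟩
    0# * h (coeff u i)                    ≈⟨ zeroˡ _ ⟩
    0#                                    ∎

  combination-scale : ∀ {n} k (xs : Vec Carrier n) us i →
    combination (Vec.map (k *_) xs) us i ≈ k * combination xs us i
  combination-scale k []       []       i = sym (zeroʳ k)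
  combination-scale k (x ∷ xs) (u ∷ us) i = begin
    (k * x) * h (coeff u i) + combination (Vec.map (k *_) xs) us i
      ≈⟨ +-cong (*-assoc k x _) (combination-scale k xs us i) ⟩
    k * (x * h (coeff u i)) + k * combination xs us i
      ≈⟨ distribˡ k _ _ ⟨
    k * (x * h (coeff u i) + combination xs us i) ∎

  h-coeff-eliminate : ∀ r u w i →
    h (coeff (eliminate r u w) i) ≈ h (coeff u r) * h (coeff w i) + (- h (coeff w r)) * h (coeff u i)
  h-coeff-eliminate r u w i = begin
    h (coeff (eliminate r u w) i)
      ≈⟨ ⟦⟧-cong (coeff-linear (coeff u r) w (R.- coeff w r) u i) ⟩
    h (coeff u r R.* coeff w i R.+ (R.- coeff w r) R.* coeff u i)
      ≈⟨ +-homo _ _ ⟩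
    h (coeff u r R.* coeff w i) + h ((R.- coeff w r) R.* coeff u i)
      ≈⟨ +-cong (*-homo _ _) (trans (*-homo _ _) (*-congʳ (-‿homo _))) ⟩
    h (coeff u r) * h (coeff w i) + (- h (coeff w r)) * h (coeff u i) ∎

  combination-eliminate : ∀ {n} r u (xs : Vec Carrier n) ws i →
    combination xs (Vec.map (eliminate r u) ws) i ≈
      h (coeff u r) * combination xs ws i + (- combination xs ws r) * h (coeff u i)
  combination-eliminate r u []       []       i = begin
    0#                                ≈⟨ +-identityʳ 0# ⟨
    0# + 0#                           ≈⟨ +-cong (zeroʳ _) (trans (*-congʳ -0#≈0#) (zeroˡ _)) ⟨
    h (coeff u r) * 0# + (- 0#) * h (coeff u i) ∎
    where open import Algebra.Properties.Ring ring using (-0#≈0#)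
  combination-eliminate r u (x ∷ xs) (w ∷ ws) i = begin
    x * h (coeff (eliminate r u w) i) + combination xs (Vec.map (eliminate r u) ws) i
      ≈⟨ +-cong (*-congˡ (h-coeff-eliminate r u w i)) (combination-eliminate r u xs ws i) ⟩
    x * (h (coeff u r) * h (coeff w i) + (- h (coeff w r)) * h (coeff u i)) +
      (h (coeff u r) * combination xs ws i + (- combination xs ws r) * h (coeff u i))
      ≈⟨ solve 7 (λ x uᵣ wᵢ wᵣ uᵢ Cᵢ Cᵣ →
             x :* (uᵣ :* wᵢ :+ (:- wᵣ) :* uᵢ) :+ (uᵣ :* Cᵢ :+ (:- Cᵣ) :* uᵢ)
          := uᵣ :* (x :* wᵢ :+ Cᵢ) :+ (:- (x :* wᵣ :+ Cᵣ)) :* uᵢ)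
          refl x (h (coeff u r)) (h (coeff w i)) (h (coeff w r)) (h (coeff u i))
               (combination xs ws i) (combination xs ws r) ⟩
    h (coeff u r) * (x * h (coeff w i) + combination xs ws i) +
      (- (x * h (coeff w r) + combination xs ws r)) * h (coeff u i) ∎

module Descent {c₁ ℓ₁ c₂ ℓ₂} {K : Field c₁ ℓ₁} {L : Field c₂ ℓ₂} (E : Extension K L)
  (_≟0 : ∀ x → Dec (Field._≈_ K x (Field.0# K))) where
  private
    module K = Field K
    module L = Field L
  open Extension E
  open RingMorphisms.IsRingHomomorphism isHom using (*-homo; 1#-homo; ⟦⟧-cong)
  open Poly K.commutativeRing using (Pol; coeff)
  open PolynomialProperties K.commutativeRing using (eliminate)
  open FieldProperties K using (x≉0⇒x*y≈0⇒y≈0)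
  open FieldProperties.WithDecidableZero K _≟0 using (≈ₚ[]⊎NonZeroPol)
  open FieldProperties L using () renaming (x≉0⇒x*y≈0⇒y≈0 to x≉0⇒x*y≈0⇒y≈0ᴸ)
  module CL = LinearCombination K.commutativeRing L.commutativeRing isHom
  module CK = LinearCombination K.commutativeRing K.commutativeRing
                (Identity.isRingHomomorphism K.rawRing K.refl)

  ι-≉0 : ∀ {x} → ¬ x K.≈ K.0# → ¬ ι x L.≈ L.0#
  ι-≉0 {x} x≉0 ιx≈0 with K.inverse x x≉0
  ... | x⁻¹ , xx⁻¹≈1 = L.1≉0 (begin
    L.1#             ≈⟨ 1#-homo ⟨
    ι K.1#           ≈⟨ ⟦⟧-cong xx⁻¹≈1 ⟨
    ι (x K.* x⁻¹)    ≈⟨ *-homo x x⁻¹ ⟩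
    ι x L.* ι x⁻¹    ≈⟨ L.*-congʳ ιx≈0 ⟩
    L.0# L.* ι x⁻¹   ≈⟨ L.zeroˡ _ ⟩
    L.0#             ∎)
    where open import Relation.Binary.Reasoning.Setoid L.setoid

  descent : ∀ {n} {us : Vec Pol n} → CL.NontrivialRelation us → CK.NontrivialRelation us
  descent {us = []}     ([] , []≉0 , _) = ⊥-elim ([]≉0 [])
  descent {us = u ∷ us} (x ∷ xs , x∷xs≉0 , rel) with ≈ₚ[]⊎NonZeroPol u
  ... | inj₁ u≈0 = K.1# ∷ Vec.tabulate (λ _ → K.0#) , (λ { (1≈0 ∷ _) → K.1≉0 1≈0 }) , rel′
    where
    rel′ : ∀ i → CK.combination (K.1# ∷ Vec.tabulate (λ _ → K.0#)) (u ∷ us) i K.≈ K.0#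
    rel′ i = K.trans (K.+-cong (K.trans (K.*-identityˡ _) (u≈0 i))
                               (CK.combination-zero us i (tabulate⁺ (λ _ → K.refl))))
                     (K.+-identityˡ K.0#)
  ... | inj₂ (r , uᵣ≉0) = extend (descent (xs , xs≉0 , rel-eliminated))
    where
    open import Algebra.Properties.Ring L.ring using (+-inverseʳ-unique)
    open IntegerCoefficients L.commutativeRing using (solve; _:=_; _:+_; _:*_; :-_; con)

    uᵣ : K.Carrier
    uᵣ = coeff u r

    rest≈-xu : ∀ j → CL.combination xs us j L.≈ L.- (x L.* ι (coeff u j))
    rest≈-xu j = +-inverseʳ-unique _ _ (rel j)

    xs≉0 : ¬ All (L._≈ L.0#) xs
    xs≉0 xs≈0 = x∷xs≉0 (x≈0 ∷ xs≈0)
      where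
      x≈0 : x L.≈ L.0#
      x≈0 = x≉0⇒x*y≈0⇒y≈0ᴸ (ι-≉0 uᵣ≉0) (L.trans (L.*-comm _ x)
              (L.trans (L.sym (L.+-identityʳ _))
                (L.trans (L.+-congˡ (L.sym (CL.combination-zero us r xs≈0))) (rel r))))

    rel-eliminated : ∀ i → CL.combination xs (Vec.map (eliminate r u) us) i L.≈ L.0#
    rel-eliminated i = L.trans (CL.combination-eliminate r u xs us i)
      (L.trans (L.+-cong (L.*-congˡ (rest≈-xu i)) (L.*-congʳ (L.-‿cong (rest≈-xu r))))
        (solve 3 (λ uᵣ x uᵢ → uᵣ :* (:- (x :* uᵢ)) :+ (:- (:- (x :* uᵣ))) :* uᵢ := con (+ 0))
               L.refl (ι uᵣ) x (ι (coeff u i))))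

    extend : CK.NontrivialRelation (Vec.map (eliminate r u) us) → CK.NontrivialRelation (u ∷ us)
    extend (ms , ms≉0 , rel-ms) = K.- CK.combination ms us r ∷ Vec.map (uᵣ K.*_) ms , ms′≉0 , rel′
      where
      ms′≉0 : ¬ All (K._≈ K.0#) (K.- CK.combination ms us r ∷ Vec.map (uᵣ K.*_) ms)
      ms′≉0 (_ ∷ uᵣms≈0) = ms≉0 (All.map (x≉0⇒x*y≈0⇒y≈0 uᵣ≉0) (map⁻ uᵣms≈0))
      rel′ : ∀ i → CK.combination (K.- CK.combination ms us r ∷ Vec.map (uᵣ K.*_) ms) (u ∷ us) i K.≈ K.0#
      rel′ i = K.trans (K.+-congˡ (CK.combination-scale uᵣ ms us i))
               (K.trans (K.+-comm _ _)
                 (K.trans (K.sym (CK.combination-eliminate r u ms us i)) (rel-ms i)))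

module _ {c ℓ} (K : Field c ℓ) where
  open Field K

  HasCardinality⇒≈-decidable : ∀ {q} → HasCardinality K q → Decidable _≈_
  HasCardinality⇒≈-decidable (e , e-injective , e-surjective) x y
    with e-surjective x | e-surjective y
  ... | i , eᵢ≈x | j , eⱼ≈y with i Fin.≟ j
  ...   | yes ≡.refl = yes (trans (sym eᵢ≈x) eⱼ≈y)
  ...   | no i≢j     = no λ x≈y → i≢j (e-injective i j (trans eᵢ≈x (trans x≈y (sym eⱼ≈y))))

module CompositionAsRelation {c₁ ℓ₁ c₂ ℓ₂} {K : Field c₁ ℓ₁} {L : Field c₂ ℓ₂} (E : Extension K L)
  (_≟0 : ∀ x → Dec (Field._≈_ K x (Field.0# K))) where
  private
    module K = Field K
    module L = Field L
    module PL = Poly L.commutativeRing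
  open Poly K.commutativeRing
  open PolynomialProperties K.commutativeRing using (*ₚ-linearʳ; *ₚ-comm)
  open PolynomialProperties L.commutativeRing using () renaming (*ₚ-linearʳ to *ₚ-linearʳᴸ)
  open Extension E
  open RingMorphisms.IsRingHomomorphism isHom using (⟦⟧-cong)
  open Descent E _≟0 using (module CK; module CL)

  products : RatFun → RatFun → Vec Pol 4
  products f g = (num f *ₚ num g) ∷ (num f *ₚ den g) ∷ (den f *ₚ num g) ∷ (den f *ₚ den g) ∷ []

  -- g = ψ ∘ f for ψ = (aX + b)/(cX + d) cross-multiplies to
  -- c N_f N_g − a N_f D_g + d D_f N_g − b D_f D_g = 0.
  coefficients : PL.Möbius → Vec L.Carrier 4
  coefficients (PL.möb a b c d _) = c ∷ L.- a ∷ d ∷ L.- b ∷ []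

  coefficients≉0 : ∀ ψ → ¬ All (L._≈ L.0#) (coefficients ψ)
  coefficients≉0 (PL.möb a b c d det≉0) (c≈0 ∷ -a≈0 ∷ _ ∷ _ ∷ []) = det≉0 (begin
    a L.* d L.- b L.* c     ≈⟨ L.+-congˡ (L.trans (L.-‿cong (L.*-comm b c)) (-‿distribʳ-* c b)) ⟩
    a L.* d L.+ c L.* L.- b ≈⟨ x≈0∧y≈0⇒xu+yv≈0 d (L.- b) (-x≈0⇒x≈0 -a≈0) c≈0 ⟩
    L.0#                    ∎)
    where
    open FieldProperties L using (x≈0∧y≈0⇒xu+yv≈0; -x≈0⇒x≈0)
    open import Algebra.Properties.Ring L.ring using (-‿distribʳ-*)
    open import Relation.Binary.Reasoning.Setoid L.setoid

  composition⇒relation : ∀ f g ψ → _≡_∘ᴸ_ E g ψ f → CL.NontrivialRelation (products f g)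
  composition⇒relation f g ψ@(PL.möb a b c d _) g≡ψ∘f = coefficients ψ , coefficients≉0 ψ , relation
    where
    open IntegerCoefficients L.commutativeRing using (solve; _:=_; _:+_; _:*_; :-_; _:-_; con)
    open import Relation.Binary.Reasoning.Setoid L.setoid

    ιcoeff-*ₚ : ∀ P Q i → PL.coeff (map ι P PL.*ₚ map ι Q) i L.≈ ι (coeff (Q *ₚ P) i)
    ιcoeff-*ₚ P Q i = L.trans (CL.coeff-map-*ₚ P Q i) (⟦⟧-cong (*ₚ-comm P Q i))

    module _ (i : ℕ) where
      n m p r : L.Carrier
      n = ι (coeff (num f *ₚ num g) i)
      m = ι (coeff (num f *ₚ den g) i)
      p = ι (coeff (den f *ₚ num g) i)
      r = ι (coeff (den f *ₚ den g) i)

      cross-multiplied : c L.* n L.+ d L.* p L.≈ a L.* m L.+ b L.* r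
      cross-multiplied = begin
        c L.* n L.+ d L.* p
          ≈⟨ L.+-cong (L.*-congˡ (ιcoeff-*ₚ (num g) (num f) i)) (L.*-congˡ (ιcoeff-*ₚ (num g) (den f) i)) ⟨
        c L.* PL.coeff (Ng PL.*ₚ Nf) i L.+ d L.* PL.coeff (Ng PL.*ₚ Df) i
          ≈⟨ *ₚ-linearʳᴸ Ng c Nf d Df i ⟨
        PL.coeff (Ng PL.*ₚ ((c PL.·ₚ Nf) PL.+ₚ (d PL.·ₚ Df))) i
          ≈⟨ g≡ψ∘f i ⟩
        PL.coeff (Dg PL.*ₚ ((a PL.·ₚ Nf) PL.+ₚ (b PL.·ₚ Df))) i
          ≈⟨ *ₚ-linearʳᴸ Dg a Nf b Df i ⟩
        a L.* PL.coeff (Dg PL.*ₚ Nf) i L.+ b L.* PL.coeff (Dg PL.*ₚ Df) i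
          ≈⟨ L.+-cong (L.*-congˡ (ιcoeff-*ₚ (den g) (num f) i)) (L.*-congˡ (ιcoeff-*ₚ (den g) (den f) i)) ⟩
        a L.* m L.+ b L.* r ∎
        where
        Nf Df Ng Dg : PL.Pol
        Nf = map ι (num f)
        Df = map ι (den f)
        Ng = map ι (num g)
        Dg = map ι (den g)

      relation : CL.combination (coefficients ψ) (products f g) i L.≈ L.0#
      relation = begin
        c L.* n L.+ (L.- a L.* m L.+ (d L.* p L.+ (L.- b L.* r L.+ L.0#)))
          ≈⟨ solve 8 (λ a b c d n m p r → c :* n :+ (:- a :* m :+ (d :* p :+ (:- b :* r :+ con (+ 0))))
                                      := (c :* n :+ d :* p) :- (a :* m :+ b :* r))
                     L.refl a b c d n m p r ⟩
        (c L.* n L.+ d L.* p) L.- (a L.* m L.+ b L.* r)   ≈⟨ L.+-congʳ cross-multiplied ⟩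
        (a L.* m L.+ b L.* r) L.- (a L.* m L.+ b L.* r)   ≈⟨ L.-‿inverseʳ _ ⟩
        L.0#                                              ∎

  relation⇒composition : ∀ f g → ¬ IsConstant f → ¬ IsConstant g → CK.NontrivialRelation (products f g) →
    ∃ λ (θ : Möbius) → IsCompOf θ (num g) (den g) (num f) (den f)
  relation⇒composition f g f-nonconst g-nonconst (m₁ ∷ m₂ ∷ m₃ ∷ m₄ ∷ [] , ms≉0 , rel) =
    möb (K.- m₃) (K.- m₄) m₁ m₂ det≉0 , f≡θ∘g
    where
    open FieldProperties K using (-x≈0⇒x≈0)
    open FieldProperties.WithDecidableZero K _≟0 using (singular-composition⇒0)
    open IntegerCoefficients K.commutativeRing using (solve; _:=_; _:+_; _:*_; :-_; con)
    open import Relation.Binary.Reasoning.Setoid K.setoid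

    f≡θ∘g : (num f *ₚ ((m₁ ·ₚ num g) +ₚ (m₂ ·ₚ den g))) ≈ₚ
            (den f *ₚ (((K.- m₃) ·ₚ num g) +ₚ ((K.- m₄) ·ₚ den g)))
    f≡θ∘g i = begin
      coeff (num f *ₚ ((m₁ ·ₚ num g) +ₚ (m₂ ·ₚ den g))) i
        ≈⟨ *ₚ-linearʳ (num f) m₁ (num g) m₂ (den g) i ⟩
      m₁ K.* n K.+ m₂ K.* m
        ≈⟨ solve 8 (λ m₁ m₂ m₃ m₄ n m p r →
               m₁ :* n :+ m₂ :* m
            := (m₁ :* n :+ (m₂ :* m :+ (m₃ :* p :+ (m₄ :* r :+ con (+ 0))))) :+ ((:- m₃) :* p :+ (:- m₄) :* r))
            K.refl m₁ m₂ m₃ m₄ n m p r ⟩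
      (m₁ K.* n K.+ (m₂ K.* m K.+ (m₃ K.* p K.+ (m₄ K.* r K.+ K.0#)))) K.+ ((K.- m₃) K.* p K.+ (K.- m₄) K.* r)
        ≈⟨ K.+-congʳ (rel i) ⟩
      K.0# K.+ ((K.- m₃) K.* p K.+ (K.- m₄) K.* r)
        ≈⟨ K.+-identityˡ _ ⟩
      (K.- m₃) K.* p K.+ (K.- m₄) K.* r
        ≈⟨ *ₚ-linearʳ (den f) (K.- m₃) (num g) (K.- m₄) (den g) i ⟨
      coeff (den f *ₚ (((K.- m₃) ·ₚ num g) +ₚ ((K.- m₄) ·ₚ den g))) i ∎
      where
      n = coeff (num f *ₚ num g) i
      m = coeff (num f *ₚ den g) i
      p = coeff (den f *ₚ num g) i
      r = coeff (den f *ₚ den g) i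

    det≉0 : ¬ ((K.- m₃) K.* m₂ K.- (K.- m₄) K.* m₁) K.≈ K.0#
    det≉0 det≈0 =
      let -m₃≈0 , -m₄≈0 , m₁≈0 , m₂≈0 =
            singular-composition⇒0 f g f-nonconst g-nonconst _ _ m₁ m₂ f≡θ∘g det≈0
      in ms≉0 (m₁≈0 ∷ m₂≈0 ∷ -x≈0⇒x≈0 -m₃≈0 ∷ -x≈0⇒x≈0 -m₄≈0 ∷ [])

lemma4p2 : ∀ {c₁ ℓ₁ c₂ ℓ₂ : Level} (q : ℕ) → IsPrimePower q →
    (Fq : Field c₁ ℓ₁) → HasCardinality Fq q →
    (F : Field c₂ ℓ₂) (E : Extension Fq F) →
    (f₁ f₂ : Poly.RatFun (Field.commutativeRing Fq)) →
    ¬ Poly.IsConstant (Field.commutativeRing Fq) f₁ →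
    ¬ Poly.IsConstant (Field.commutativeRing Fq) f₂ →
    (∃ λ (ψ : Poly.Möbius (Field.commutativeRing F)) → _≡_∘ᴸ_ E f₂ ψ f₁) →
    ∃ λ (θ : Poly.Möbius (Field.commutativeRing Fq)) →
    Poly.IsCompOf (Field.commutativeRing Fq) θ
    (Poly.num f₂) (Poly.den f₂) (Poly.num f₁) (Poly.den f₁)
lemma4p2 q _ Fq card F E f₁ f₂ f₁-nonconst f₂-nonconst (ψ , f₂≡ψ∘f₁) =
  relation⇒composition f₁ f₂ f₁-nonconst f₂-nonconst
    (descent (composition⇒relation f₁ f₂ ψ f₂≡ψ∘f₁))
  where
  _≟0 : ∀ x → Dec (Field._≈_ Fq x (Field.0# Fq))
  x ≟0 = HasCardinality⇒≈-decidable Fq card x (Field.0# Fq)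
  open CompositionAsRelation E _≟0 using (composition⇒relation; relation⇒composition)
  open Descent E _≟0 using (descent)
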